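{- Let $n\ge2$, ${\cal I}=\{(i,j)\mid 1\le i\le n,\ 1\le j\le n+1\}$ and $S=\{(i,j)\in{\cal I}\mid i+j\le n+1\}$. Let $X\ne Y$ be tables in the same fiber and $Z=(z_{ij})=X-Y$. Suppose there are rows $i_a,i_b,i_c,i_d$ with $z_{i_a1}>0$, $z_{i_b,n+1}>0$, $z_{i_c1}<0$, $z_{i_d,n+1}<0$, satisfying one of $i_a<i_c<i_b$, $i_a<i_d<i_b$, $i_b<i_c<i_a$, $i_b<i_d<i_a$. Then $\Vert X-Y\Vert_1$ can be reduced by ${\cal B}_0(S)$.
   Context: A table is an array on ${\cal I}$ with entries in $\mathbb{N}=\{0,1,\dots\}$; the fiber of $X$ is the set of tables with the same row sums, column sums and sum of entries over $S$. For $i\ne i'$, $j\ne j'$, the basic move $B(i,i';j,j')$ has $+1$ at $(i,j),(i',j')$, $-1$ at $(i,j'),(i',j)$, $0$ elsewhere; ${\cal B}_0(S)$ is the set of basic moves whose entries over $S$ sum to $0$. $\Vert W\Vert_1=\sum|w_{ij}|$. For $X\ne Y$ in the same fiber ${\cal F}$, $\Vert X-Y\Vert_1$ can be reduced by ${\cal B}_0(S)$ if there exist $\tau^+,\tau^-\ge0$, $\tau^++\tau^->0$, and $B^+_1,\dots,B^+_{\tau^+},B^-_1,\dots,B^-_{\tau^- }\in{\cal B}_0(S)$ with $X+\sum_{t=1}^{\tau'}B^+_t\in{\cal F}$ ($\tau'=1,\dots,\tau^+$), $Y-\sum_{t=1}^{\tau'}B^-_t\in{\cal F}$ ($\tau'=1,\dots,\tau^-$),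 and $\Vert X-Y+\sum_t B^+_t+\sum_t B^-_t\Vert_1<\Vert X-Y\Vert_1$. -}

module Defs where

open import Data.Nat as ℕ using (ℕ; zero; suc)
open import Data.Integer as ℤ using (ℤ; +_; _-_; ∣_∣)
open import Data.Fin using (Fin; zero; suc; toℕ; _≟_)
open import Data.List using (List; []; _∷_; take; length)
open import Data.List.Relation.Unary.All using (All)
open import Data.Product using (_×_; Σ; Σ-syntax)
open import Relation.Nullary using (¬_; yes; no)
open import Relation.Binary.PropositionalEquality using (_≡_)

-- Rows are indexed by Fin n (row i = toℕ i + 1), columns by Fin (suc n)
-- (column j = toℕ j + 1).  A table is an ℕ-valued array; moves and
-- differences are ℤ-valued arrays.
Table : ℕ → Set
Table n = Fin n → Fin (suc n) → ℕ

Arr : ℕ → Set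
Arr n = Fin n → Fin (suc n) → ℤ

∑ : ∀ {m} → (Fin m → ℤ) → ℤ
∑ {zero}  f = + 0
∑ {suc m} f = f zero ℤ.+ ∑ (λ k → f (suc k))

-- the subset S = {(i,j) | i + j ≤ n + 1} in 1-based indices
inS : ∀ {n} → Fin n → Fin (suc n) → ℤ
inS {n} i j with (toℕ i ℕ.+ toℕ j) ℕ.<? n
... | yes _ = + 1
... | no  _ = + 0

-- a general subset given by its 0/1 indicator
Subset : ℕ → Set
Subset n = Fin n → Fin (suc n) → ℤ

toArr : ∀ {n} → Table n → Arr n
toArr X i j = + (X i j)

rowSum : ∀ {n} → Arr n → Fin n → ℤ
rowSum W i = ∑ (λ j → W i j)

colSum : ∀ {n} → Arr n → Fin (suc n) → ℤ
colSum W j = ∑ (λ i → W i j)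

SSum : ∀ {n} → Subset n → Arr n → ℤ
SSum S W = ∑ (λ i → ∑ (λ j → S i j ℤ.* W i j))

InFiber : ∀ {n} → Subset n → Table n → Arr n → Set
InFiber S X W =
  (∀ i j → + 0 ℤ.≤ W i j) ×
  (∀ i → rowSum W i ≡ rowSum (toArr X) i) ×
  (∀ j → colSum W j ≡ colSum (toArr X) j) ×
  (SSum S W ≡ SSum S (toArr X))

SameFiber : ∀ {n} → Subset n → Table n → Table n → Set
SameFiber S X Y = InFiber S X (toArr Y)

record BasicMove (n : ℕ) : Set where
  constructor bm
  field
    i i' : Fin n
    j j' : Fin (suc n)
    i≢i' : ¬ i ≡ i'
    j≢j' : ¬ j ≡ j'

δ : ∀ {m} → Fin m → Fin m → ℤ
δ a b with a ≟ b
... | yes _ = + 1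
... | no  _ = + 0

moveArr : ∀ {n} → BasicMove n → Arr n
moveArr (bm i i' j j' _ _) a b =
  (δ a i ℤ.* δ b j ℤ.+ δ a i' ℤ.* δ b j')
  - (δ a i ℤ.* δ b j' ℤ.+ δ a i' ℤ.* δ b j)

InB0 : ∀ {n} → Subset n → BasicMove n → Set
InB0 S B = SSum S (moveArr B) ≡ + 0

_⊕_ : ∀ {n} → Arr n → Arr n → Arr n
(V ⊕ W) i j = V i j ℤ.+ W i j

_⊖_ : ∀ {n} → Arr n → Arr n → Arr n
(V ⊖ W) i j = V i j - W i j

zeroArr : ∀ {n} → Arr n
zeroArr i j = + 0

sumMoves : ∀ {n} → List (BasicMove n) → Arr n
sumMoves []       = zeroArr
sumMoves (B ∷ Bs) = moveArr B ⊕ sumMoves Bs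

norm1 : ∀ {n} → Arr n → ℕ
norm1 {n} W = ∣ ∑ (λ i → ∑ (λ j → + ∣ W i j ∣)) ∣

Reducible : ∀ {n} → Subset n → Table n → Table n → Set
Reducible {n} S X Y =
  Σ[ Bp ∈ List (BasicMove n) ] Σ[ Bm ∈ List (BasicMove n) ]
    (All (InB0 S) Bp × All (InB0 S) Bm ×
     0 ℕ.< length Bp ℕ.+ length Bm ×
     (∀ k → 1 ℕ.≤ k → k ℕ.≤ length Bp →
        InFiber S X (toArr X ⊕ sumMoves (take k Bp))) ×
     (∀ k → 1 ℕ.≤ k → k ℕ.≤ length Bm →
        InFiber S X (toArr Y ⊖ sumMoves (take k Bm))) ×
     norm1 (((toArr X ⊖ toArr Y) ⊕ sumMoves Bp) ⊕ sumMoves Bm)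
       ℕ.< norm1 (toArr X ⊖ toArr Y))

-- Write Z = X − Y.  Column 1 meets S in every row and column n+1 in none, so a
-- basic move on two rows, one of these two columns and a further column j lies
-- in B₀(S) as soon as the two rows agree about S in column j.  Since Z has zero
-- row sums, the row i_c with z_{i_c 1} < 0 has a positive entry in some column j,
-- and since S is a staircase, a row between i_a and i_b agrees about S in column j
-- with row i_a or with row i_b.  In the first case B(i_c,i_a;1,j), in the second
-- B(i_c,i_b;n+1,j) followed by B(i_c,i_a;1,n+1), added to X lowers ‖Z‖₁ by at
-- least two: three resp. four entries move towards zero, one resp. two may move
-- away.  The moves only subtract from entries where X > Y ≥ 0, or from an entry
-- the previous move raised, so X stays a table.  The case of i_d is the mirror
-- image.
module Submission where

open import Defs
open import Data.Nat using (ℕ; suc; _≤_)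
open import Data.Integer using (+_; _<_)
open import Data.Fin using (Fin; zero; fromℕ) renaming (_<_ to _<ᶠ_)
open import Data.Product using (_×_)
open import Data.Sum using (_⊎_)
open import Relation.Nullary using (¬_)
open import Relation.Binary.PropositionalEquality using (_≡_)

open import Data.Nat as ℕ using (z≤n; s≤s)
import Data.Nat.Properties as ℕP
open import Data.Integer as ℤ using (ℤ; -[1+_]; ∣_∣; _+_; _*_; _-_; -_; +≤+)
import Data.Integer.Properties as ℤP
open import Data.Integer.Tactic.RingSolver using (solve-∀)
open import Data.Fin as Fin using (toℕ; _≟_)
import Data.Fin.Properties as FinP
open import Data.Product using (_,_; ∃; proj₁; proj₂; map₂)
open import Data.Sum using (inj₁; inj₂; swap)
open import Data.List using (List; []; _∷_; take; length)
open import Data.List.Relation.Unary.All using (All; []; _∷_)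
open import Function using (_∘_)
open import Relation.Nullary using (yes; no; contradiction)
open import Relation.Binary.PropositionalEquality
  using (refl; sym; trans; cong; cong₂; subst; _≢_; ≢-sym; module ≡-Reasoning)
open import Algebra.Properties.CommutativeMonoid.Sum ℤP.+-0-commutativeMonoid
  using (sum; sum-cong-≗; ∑-distrib-+; sum-replicate-zero)

∑≡sum : ∀ {m} (f : Fin m → ℤ) → ∑ f ≡ sum f
∑≡sum {0}     f = refl
∑≡sum {suc m} f = cong (_+_ (f zero)) (∑≡sum (f ∘ Fin.suc))

∑-cong : ∀ {m} {f g : Fin m → ℤ} → (∀ k → f k ≡ g k) → ∑ f ≡ ∑ g
∑-cong {f = f} {g} f≗g = trans (∑≡sum f) (trans (sum-cong-≗ f≗g) (sym (∑≡sum g)))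

∑-+ : ∀ {m} (f g : Fin m → ℤ) → ∑ (λ k → f k + g k) ≡ ∑ f + ∑ g
∑-+ f g = trans (∑≡sum (λ k → f k + g k))
  (trans (∑-distrib-+ f g) (sym (cong₂ _+_ (∑≡sum f) (∑≡sum g))))

∑-zero : ∀ {m} → ∑ {m} (λ _ → + 0) ≡ + 0
∑-zero {m} = trans (∑≡sum {m} (λ _ → + 0)) (sum-replicate-zero m)

∑-neg : ∀ {m} (f : Fin m → ℤ) → ∑ (λ k → - f k) ≡ - ∑ f
∑-neg {0}     f = refl
∑-neg {suc m} f = trans (cong (_+_ (- f zero)) (∑-neg (f ∘ Fin.suc))) (sym (ℤP.neg-distrib-+ (f zero) _))

∑-− : ∀ {m} (f g : Fin m → ℤ) → ∑ (λ k → f k - g k) ≡ ∑ f - ∑ g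
∑-− f g = trans (∑-+ f (λ k → - g k)) (cong (_+_ (∑ f)) (∑-neg g))

∑-mono-≤ : ∀ {m} {f g : Fin m → ℤ} → (∀ k → f k ℤ.≤ g k) → ∑ f ℤ.≤ ∑ g
∑-mono-≤ {0}     _   = ℤP.≤-refl
∑-mono-≤ {suc m} f≤g = ℤP.+-mono-≤ (f≤g zero) (∑-mono-≤ (f≤g ∘ Fin.suc))

∑-mono-< : ∀ {m} {f g : Fin m → ℤ} → (∀ k → f k ℤ.≤ g k) → ∀ c → f c < g c → ∑ f < ∑ g
∑-mono-< f≤g zero        fc<gc = ℤP.+-mono-<-≤ fc<gc (∑-mono-≤ (f≤g ∘ Fin.suc))
∑-mono-< f≤g (Fin.suc c) fc<gc = ℤP.+-mono-≤-< (f≤g zero) (∑-mono-< (f≤g ∘ Fin.suc) c fc<gc)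

∑-nonneg : ∀ {m} {f : Fin m → ℤ} → (∀ k → + 0 ℤ.≤ f k) → + 0 ℤ.≤ ∑ f
∑-nonneg {m} {f} f≥0 = subst (ℤ._≤ ∑ f) (∑-zero {m}) (∑-mono-≤ f≥0)

δ-refl : ∀ {m} (a : Fin m) → δ a a ≡ + 1
δ-refl a with a ≟ a
... | yes _   = refl
... | no a≢a = contradiction refl a≢a

δ-≢ : ∀ {m} {a b : Fin m} → a ≢ b → δ a b ≡ + 0
δ-≢ {a = a} {b} a≢b with a ≟ b
... | yes a≡b = contradiction a≡b a≢b
... | no _    = refl

δ-suc : ∀ {m} (a b : Fin m) → δ (Fin.suc a) (Fin.suc b) ≡ δ a b
δ-suc a b with a ≟ b
... | yes _ = refl
... | no _  = refl

∑-δ : ∀ {m} (f : Fin m → ℤ) (q : Fin m) → ∑ (λ k → f k * δ k q) ≡ f q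
∑-δ {suc m} f zero = begin
  f zero * + 1 + ∑ (λ k → f (Fin.suc k) * + 0)
    ≡⟨ cong₂ _+_ (ℤP.*-identityʳ (f zero)) (∑-cong (ℤP.*-zeroʳ ∘ f ∘ Fin.suc)) ⟩
  f zero + ∑ {m} (λ _ → + 0)  ≡⟨ cong (_+_ (f zero)) (∑-zero {m}) ⟩
  f zero + + 0                ≡⟨ ℤP.+-identityʳ (f zero) ⟩
  f zero                      ∎
  where open ≡-Reasoning
∑-δ f (Fin.suc q) = begin
  f zero * + 0 + ∑ (λ k → f (Fin.suc k) * δ (Fin.suc k) (Fin.suc q))
    ≡⟨ cong₂ _+_ (ℤP.*-zeroʳ (f zero)) (∑-cong (λ k → cong (f (Fin.suc k) *_) (δ-suc k q))) ⟩
  + 0 + ∑ (λ k → f (Fin.suc k) * δ k q)  ≡⟨ ℤP.+-identityˡ _ ⟩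
  ∑ (λ k → f (Fin.suc k) * δ k q)        ≡⟨ ∑-δ (f ∘ Fin.suc) q ⟩
  f (Fin.suc q)                          ∎
  where open ≡-Reasoning

∑∑ : ∀ {n} → Arr n → ℤ
∑∑ W = ∑ (λ a → ∑ (W a))

∑∑-cong : ∀ {n} {V W : Arr n} → (∀ a b → V a b ≡ W a b) → ∑∑ V ≡ ∑∑ W
∑∑-cong V≗W = ∑-cong (λ a → ∑-cong (V≗W a))

∑∑-⊕ : ∀ {n} (V W : Arr n) → ∑∑ (V ⊕ W) ≡ ∑∑ V + ∑∑ W
∑∑-⊕ V W = trans (∑-cong (λ a → ∑-+ (V a) (W a))) (∑-+ (λ a → ∑ (V a)) (λ a → ∑ (W a)))

∑∑-⊖ : ∀ {n} (V W : Arr n) → ∑∑ (V ⊖ W) ≡ ∑∑ V - ∑∑ W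
∑∑-⊖ V W = trans (∑-cong (λ a → ∑-− (V a) (W a))) (∑-− (λ a → ∑ (V a)) (λ a → ∑ (W a)))

∑∑-nonneg : ∀ {n} {W : Arr n} → (∀ a b → + 0 ℤ.≤ W a b) → + 0 ℤ.≤ ∑∑ W
∑∑-nonneg W≥0 = ∑-nonneg (λ a → ∑-nonneg (W≥0 a))

E : ∀ {n} → Fin n → Fin (suc n) → Arr n
E p q a b = δ a p * δ b q

E-at : ∀ {n} (p : Fin n) (q : Fin (suc n)) → E p q p q ≡ + 1
E-at p q = cong₂ _*_ (δ-refl p) (δ-refl q)

E-cases : ∀ {n} (p : Fin n) (q : Fin (suc n)) a b → (a ≡ p × b ≡ q) ⊎ E p q a b ≡ + 0
E-cases p q a b with a ≟ p | b ≟ q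
... | yes a≡p | yes b≡q = inj₁ (a≡p , b≡q)
... | no _    | _       = inj₂ refl
... | yes _   | no _    = inj₂ refl

E-nonneg : ∀ {n} (p : Fin n) (q : Fin (suc n)) a b → + 0 ℤ.≤ E p q a b
E-nonneg p q a b with E-cases p q a b
... | inj₁ (refl , refl) = subst (+ 0 ℤ.≤_) (sym (E-at p q)) (+≤+ z≤n)
... | inj₂ E≡0           = ℤP.≤-reflexive (sym E≡0)

∑∑-E : ∀ {n} (W : Arr n) p q → ∑∑ (λ a b → W a b * E p q a b) ≡ W p q
∑∑-E W p q = trans (∑-cong row) (∑-δ (λ a → W a q) p)
  where
  row : ∀ a → ∑ (λ b → W a b * E p q a b) ≡ W a q * δ a p
  row a = trans (∑-cong (λ b → sym (ℤP.*-assoc (W a b) (δ a p) (δ b q)))) (∑-δ (λ b → W a b * δ a p) q)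

[x+y]-[y+x]≡0 : ∀ x y → (x + y) - (y + x) ≡ + 0
[x+y]-[y+x]≡0 x y = trans (cong (_-_ (x + y)) (ℤP.+-comm y x)) (ℤP.+-inverseʳ (x + y))

record Linear {n} (L : Arr n → ℤ) (w : Arr n) : Set where
  field
    ⊕-hom : ∀ V W → L (V ⊕ W) ≡ L V + L W
    ⊖-hom : ∀ V W → L (V ⊖ W) ≡ L V - L W
    E-hom : ∀ p q → L (E p q) ≡ w p q

  ⊕-null : ∀ V W → L W ≡ + 0 → L (V ⊕ W) ≡ L V
  ⊕-null V W LW≡0 = trans (⊕-hom V W) (trans (cong (_+_ (L V)) LW≡0) (ℤP.+-identityʳ (L V)))

  moveArr-hom : (B : BasicMove n) → let open BasicMove B in
    L (moveArr B) ≡ (w i j + w i' j') - (w i j' + w i' j)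
  moveArr-hom (bm i i' j j' _ _) = begin
    L ((E i j ⊕ E i' j') ⊖ (E i j' ⊕ E i' j))
      ≡⟨ ⊖-hom (E i j ⊕ E i' j') (E i j' ⊕ E i' j) ⟩
    L (E i j ⊕ E i' j') - L (E i j' ⊕ E i' j)
      ≡⟨ cong₂ _-_ (⊕-hom (E i j) (E i' j')) (⊕-hom (E i j') (E i' j)) ⟩
    (L (E i j) + L (E i' j')) - (L (E i j') + L (E i' j))
      ≡⟨ cong₂ _-_ (cong₂ _+_ (E-hom i j) (E-hom i' j')) (cong₂ _+_ (E-hom i j') (E-hom i' j)) ⟩
    (w i j + w i' j') - (w i j' + w i' j)
      ∎
    where open ≡-Reasoning

open Linear

rowSum-linear : ∀ {n} (a : Fin n) → Linear (λ W → rowSum W a) (λ p _ → δ a p)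
rowSum-linear a = record
  { ⊕-hom = λ V W → ∑-+ (V a) (W a)
  ; ⊖-hom = λ V W → ∑-− (V a) (W a)
  ; E-hom = λ p q → ∑-δ (λ _ → δ a p) q
  }

colSum-linear : ∀ {n} (b : Fin (suc n)) → Linear (λ W → colSum W b) (λ _ q → δ b q)
colSum-linear b = record
  { ⊕-hom = λ V W → ∑-+ (λ a → V a b) (λ a → W a b)
  ; ⊖-hom = λ V W → ∑-− (λ a → V a b) (λ a → W a b)
  ; E-hom = λ p q → trans (∑-cong (λ a → ℤP.*-comm (δ a p) (δ b q))) (∑-δ (λ _ → δ b q) p)
  }

SSum-linear : ∀ {n} (S : Subset n) → Linear (SSum S) S
SSum-linear S = record
  { ⊕-hom = λ V W → trans (∑∑-cong (λ a b → ℤP.*-distribˡ-+ (S a b) (V a b) (W a b)))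
                          (∑∑-⊕ (λ a b → S a b * V a b) (λ a b → S a b * W a b))
  ; ⊖-hom = λ V W → trans (∑∑-cong (λ a b → *-distribˡ-− (S a b) (V a b) (W a b)))
                          (∑∑-⊖ (λ a b → S a b * V a b) (λ a b → S a b * W a b))
  ; E-hom = ∑∑-E S
  }
  where
  *-distribˡ-− : ∀ s v w → s * (v - w) ≡ s * v - s * w
  *-distribˡ-− s v w = trans (ℤP.*-distribˡ-+ s v (- w)) (cong (_+_ (s * v)) (sym (ℤP.neg-distribʳ-* s w)))

InFiber-cong : ∀ {n} {S : Subset n} {X : Table n} {V W : Arr n} →
  (∀ a b → V a b ≡ W a b) → InFiber S X V → InFiber S X W
InFiber-cong {S = S} V≗W (V≥0 , rows , cols , sS) =
  (λ a b → subst (+ 0 ℤ.≤_) (V≗W a b) (V≥0 a b)) ,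
  (λ a → trans (sym (∑-cong (V≗W a))) (rows a)) ,
  (λ b → trans (sym (∑-cong (λ a → V≗W a b))) (cols b)) ,
  trans (sym (∑∑-cong (λ a b → cong (_*_ (S a b)) (V≗W a b)))) sS

InFiber-refl : ∀ {n} {S : Subset n} {X : Table n} → InFiber S X (toArr X)
InFiber-refl = (λ _ _ → +≤+ z≤n) , (λ _ → refl) , (λ _ → refl) , refl

module _ {n} (B : BasicMove n) where
  open BasicMove B

  rowSum-moveArr : ∀ a → rowSum (moveArr B) a ≡ + 0
  rowSum-moveArr a = trans (moveArr-hom (rowSum-linear a) B) (ℤP.+-inverseʳ (δ a i + δ a i'))

  colSum-moveArr : ∀ b → colSum (moveArr B) b ≡ + 0
  colSum-moveArr b = trans (moveArr-hom (colSum-linear b) B) ([x+y]-[y+x]≡0 (δ b j) (δ b j'))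

  InB0-of-columns : ∀ {S : Subset n} → S i j ≡ S i' j → S i j' ≡ S i' j' → InB0 S B
  InB0-of-columns {S} Sj Sj' = begin
    SSum S (moveArr B)                    ≡⟨ moveArr-hom (SSum-linear S) B ⟩
    (S i j + S i' j') - (S i j' + S i' j) ≡⟨ cong₂ (λ x y → (x + S i' j') - (y + S i' j)) Sj Sj' ⟩
    (S i' j + S i' j') - (S i' j' + S i' j) ≡⟨ [x+y]-[y+x]≡0 (S i' j) (S i' j') ⟩
    + 0                                   ∎
    where open ≡-Reasoning

  moveArr-ij : moveArr B i j ≡ + 1
  moveArr-ij rewrite δ-refl i | δ-refl j | δ-≢ i≢i' | δ-≢ j≢j' = refl

  moveArr-ij' : moveArr B i j' ≡ -[1+ 0 ]
  moveArr-ij' rewrite δ-refl i | δ-refl j' | δ-≢ i≢i' | δ-≢ (≢-sym j≢j') = refl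

  moveArr-i'j : moveArr B i' j ≡ -[1+ 0 ]
  moveArr-i'j rewrite δ-refl i' | δ-refl j | δ-≢ (≢-sym i≢i') | δ-≢ j≢j' = refl

  moveArr-outside : ∀ a {b} → b ≢ j → b ≢ j' → moveArr B a b ≡ + 0
  moveArr-outside a b≢j b≢j'
    rewrite δ-≢ b≢j | δ-≢ b≢j' | ℤP.*-zeroʳ (δ a i) | ℤP.*-zeroʳ (δ a i') = refl

  ⊕-moveArr-nonneg : ∀ {W : Arr n} → (∀ a b → + 0 ℤ.≤ W a b) → + 1 ℤ.≤ W i j' → + 1 ℤ.≤ W i' j →
    ∀ a b → + 0 ℤ.≤ (W ⊕ moveArr B) a b
  ⊕-moveArr-nonneg {W} W≥0 1≤Wij' 1≤Wi'j a b with E-cases i j' a b | E-cases i' j a b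
  ... | inj₁ (refl , refl) | _ =
    subst (λ m → + 0 ℤ.≤ W i j' + m) (sym moveArr-ij') (ℤP.i≤j⇒0≤j-i 1≤Wij')
  ... | inj₂ _ | inj₁ (refl , refl) =
    subst (λ m → + 0 ℤ.≤ W i' j + m) (sym moveArr-i'j) (ℤP.i≤j⇒0≤j-i 1≤Wi'j)
  ... | inj₂ E≡0 | inj₂ E'≡0 = ℤP.+-mono-≤ (W≥0 a b) M≥0
    where
    M≥0 : + 0 ℤ.≤ moveArr B a b
    M≥0 rewrite E≡0 | E'≡0 | ℤP.+-identityʳ (E i j a b + E i' j' a b) =
      ℤP.+-mono-≤ (E-nonneg i j a b) (E-nonneg i' j' a b)

  InFiber-moveArr : ∀ {S : Subset n} {X : Table n} {W : Arr n} → InFiber S X W → InB0 S B →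
    + 1 ℤ.≤ W i j' → + 1 ℤ.≤ W i' j → InFiber S X (W ⊕ moveArr B)
  InFiber-moveArr {S} {W = W} (W≥0 , rows , cols , sS) B∈B₀ 1≤Wij' 1≤Wi'j =
    ⊕-moveArr-nonneg W≥0 1≤Wij' 1≤Wi'j ,
    (λ a → trans (⊕-null (rowSum-linear a) W (moveArr B) (rowSum-moveArr a)) (rows a)) ,
    (λ b → trans (⊕-null (colSum-linear b) W (moveArr B) (colSum-moveArr b)) (cols b)) ,
    trans (⊕-null (SSum-linear S) W (moveArr B) B∈B₀) sS

∑∑-∣∣ : ∀ {n} (W : Arr n) → ∑∑ (λ a b → + ∣ W a b ∣) ≡ + norm1 W
∑∑-∣∣ W = sym (ℤP.0≤i⇒+∣i∣≡i (∑∑-nonneg {W = λ a b → + ∣ W a b ∣} (λ _ _ → +≤+ z≤n)))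

norm1-cong : ∀ {n} {V W : Arr n} → (∀ a b → V a b ≡ W a b) → norm1 V ≡ norm1 W
norm1-cong V≗W = cong ∣_∣ (∑∑-cong (λ a b → cong (+_ ∘ ∣_∣) (V≗W a b)))

upd : ∀ {n} → Arr n → ℤ → Fin n → Fin (suc n) → Arr n
upd W s p q a b = W a b + s * E p q a b

upd-≢ : ∀ {n} (W : Arr n) s p q {a b} → ¬ (a ≡ p × b ≡ q) → upd W s p q a b ≡ W a b
upd-≢ W s p q {a} {b} ≢pq with E-cases p q a b
... | inj₁ ≡pq = contradiction ≡pq ≢pq
... | inj₂ E≡0 rewrite E≡0 | ℤP.*-zeroʳ s = ℤP.+-identityʳ (W a b)

norm1-upd : ∀ {n} (W : Arr n) s p q → ∣ W p q ∣ ℕ.+ norm1 (upd W s p q) ≡ ∣ W p q + s ∣ ℕ.+ norm1 W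
norm1-upd W s p q = ℤP.+-injective (begin
  + (∣ x ∣ ℕ.+ norm1 U)
    ≡⟨ ℤP.pos-+ ∣ x ∣ (norm1 U) ⟩
  + ∣ x ∣ + + norm1 U
    ≡⟨ cong₂ _+_ (∑∑-E (λ _ _ → + ∣ x ∣) p q) (∑∑-∣∣ U) ⟨
  ∑∑ (λ a b → + ∣ x ∣ * E p q a b) + ∑∑ (λ a b → + ∣ U a b ∣)
    ≡⟨ ∑∑-⊕ (λ a b → + ∣ x ∣ * E p q a b) (λ a b → + ∣ U a b ∣) ⟨
  ∑∑ (λ a b → + ∣ x ∣ * E p q a b + + ∣ U a b ∣)
    ≡⟨ ∑∑-cong entrywise ⟩
  ∑∑ (λ a b → + ∣ x + s ∣ * E p q a b + + ∣ W a b ∣)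
    ≡⟨ ∑∑-⊕ (λ a b → + ∣ x + s ∣ * E p q a b) (λ a b → + ∣ W a b ∣) ⟩
  ∑∑ (λ a b → + ∣ x + s ∣ * E p q a b) + ∑∑ (λ a b → + ∣ W a b ∣)
    ≡⟨ cong₂ _+_ (∑∑-E (λ _ _ → + ∣ x + s ∣) p q) (∑∑-∣∣ W) ⟩
  + ∣ x + s ∣ + + norm1 W
    ≡⟨ ℤP.pos-+ ∣ x + s ∣ (norm1 W) ⟨
  + (∣ x + s ∣ ℕ.+ norm1 W)
    ∎)
  where
  open ≡-Reasoning
  x = W p q
  U = upd W s p q
  entrywise : ∀ a b → + ∣ x ∣ * E p q a b + + ∣ U a b ∣ ≡ + ∣ x + s ∣ * E p q a b + + ∣ W a b ∣
  entrywise a b with E-cases p q a b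
  ... | inj₁ (refl , refl)
    rewrite E-at a b | ℤP.*-identityʳ s | ℤP.*-identityʳ (+ ∣ W a b ∣) | ℤP.*-identityʳ (+ ∣ W a b + s ∣)
    = ℤP.+-comm (+ ∣ W a b ∣) (+ ∣ W a b + s ∣)
  ... | inj₂ E≡0
    rewrite E≡0 | ℤP.*-zeroʳ s | ℤP.+-identityʳ (W a b)
          | ℤP.*-zeroʳ (+ ∣ x ∣) | ℤP.*-zeroʳ (+ ∣ x + s ∣)
    = refl

norm1-upd-< : ∀ {n} (W : Arr n) s p q → ∣ W p q + s ∣ ℕ.< ∣ W p q ∣ → norm1 (upd W s p q) ℕ.< norm1 W
norm1-upd-< W s p q shrinks = ℕP.+-cancelˡ-< ∣ W p q ∣ _ _ (begin-strict
  ∣ W p q ∣ ℕ.+ norm1 (upd W s p q) ≡⟨ norm1-upd W s p q ⟩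
  ∣ W p q + s ∣ ℕ.+ norm1 W         <⟨ ℕP.+-monoˡ-< (norm1 W) shrinks ⟩
  ∣ W p q ∣ ℕ.+ norm1 W             ∎)
  where open ℕP.≤-Reasoning

norm1-upd-≤ : ∀ {n} (W : Arr n) s p q → norm1 (upd W s p q) ≤ ∣ s ∣ ℕ.+ norm1 W
norm1-upd-≤ W s p q = ℕP.+-cancelˡ-≤ ∣ W p q ∣ _ _ (begin
  ∣ W p q ∣ ℕ.+ norm1 (upd W s p q) ≡⟨ norm1-upd W s p q ⟩
  ∣ W p q + s ∣ ℕ.+ norm1 W         ≤⟨ ℕP.+-monoˡ-≤ (norm1 W) (ℤP.∣i+j∣≤∣i∣+∣j∣ (W p q) s) ⟩
  ∣ W p q ∣ ℕ.+ ∣ s ∣ ℕ.+ norm1 W   ≡⟨ ℕP.+-assoc ∣ W p q ∣ ∣ s ∣ (norm1 W) ⟩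
  ∣ W p q ∣ ℕ.+ (∣ s ∣ ℕ.+ norm1 W) ∎)
  where open ℕP.≤-Reasoning

norm1-upd-pos : ∀ {n} (W : Arr n) p q → + 0 < W p q → norm1 (upd W -[1+ 0 ] p q) ℕ.< norm1 W
norm1-upd-pos W p q 0<Wpq = norm1-upd-< W -[1+ 0 ] p q (shrinks (W p q) 0<Wpq)
  where
  shrinks : ∀ x → + 0 < x → ∣ x + -[1+ 0 ] ∣ ℕ.< ∣ x ∣
  shrinks (+ suc m) _ = ℕP.n<1+n m
  shrinks (+ 0) (ℤ.+<+ ())

norm1-upd-neg : ∀ {n} (W : Arr n) p q → W p q < + 0 → norm1 (upd W (+ 1) p q) ℕ.< norm1 W
norm1-upd-neg W p q Wpq<0 = norm1-upd-< W (+ 1) p q (shrinks (W p q) Wpq<0)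
  where
  shrinks : ∀ x → x < + 0 → ∣ x + + 1 ∣ ℕ.< ∣ x ∣
  shrinks -[1+ 0 ]     _ = ℕP.n<1+n 0
  shrinks -[1+ suc m ] _ = ℕP.n<1+n (suc m)
  shrinks (+ _) (ℤ.+<+ ())

norm1-⊕-moveArr-< : ∀ {n} {W : Arr n} (B : BasicMove n) → let open BasicMove B in
  + 0 < W i j' → + 0 < W i' j → W i j < + 0 → norm1 (W ⊕ moveArr B) ℕ.< norm1 W
norm1-⊕-moveArr-< {W = W} (bm i i' j j' i≢i' j≢j') 0<Wij' 0<Wi'j Wij<0 = begin-strict
  norm1 (W ⊕ moveArr (bm i i' j j' i≢i' j≢j'))
    ≡⟨ norm1-cong (λ a b → as-updates (W a b) (E i j a b) (E i' j' a b) (E i j' a b) (E i' j a b)) ⟩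
  norm1 W₄        ≤⟨ norm1-upd-≤ W₃ (+ 1) i' j' ⟩
  suc (norm1 W₃)  ≤⟨ norm1-upd-pos W₂ i' j (subst (+ 0 <_) (sym W₂-at-i'j) 0<Wi'j) ⟩
  norm1 W₂        <⟨ norm1-upd-pos W₁ i j' (subst (+ 0 <_) (sym W₁-at-ij') 0<Wij') ⟩
  norm1 W₁        <⟨ norm1-upd-neg W i j Wij<0 ⟩
  norm1 W         ∎
  where
  open ℕP.≤-Reasoning
  -- The entries moving towards 0 are updated first, while they still hold their values in W.
  W₁ W₂ W₃ W₄ : Arr _
  W₁ = upd W (+ 1) i j
  W₂ = upd W₁ -[1+ 0 ] i j'
  W₃ = upd W₂ -[1+ 0 ] i' j
  W₄ = upd W₃ (+ 1) i' j'
  as-updates : ∀ w e₁ e₂ e₃ e₄ →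
    w + ((e₁ + e₂) - (e₃ + e₄)) ≡ (((w + + 1 * e₁) + -[1+ 0 ] * e₃) + -[1+ 0 ] * e₄) + + 1 * e₂
  as-updates = solve-∀
  W₁-at-ij' : W₁ i j' ≡ W i j'
  W₁-at-ij' = upd-≢ W (+ 1) i j (j≢j' ∘ sym ∘ proj₂)
  W₂-at-i'j : W₂ i' j ≡ W i' j
  W₂-at-i'j = trans (upd-≢ W₁ -[1+ 0 ] i j' (i≢i' ∘ sym ∘ proj₁))
                    (upd-≢ W (+ 1) i j (i≢i' ∘ sym ∘ proj₁))

norm1-⊕-two-moves-< : ∀ {n} {W : Arr n} {ra rb rc c0 c1 j}
  (rc≢rb : rc ≢ rb) (c1≢j : c1 ≢ j) (rc≢ra : rc ≢ ra) (c0≢c1 : c0 ≢ c1) →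
  + 0 < W rc j → + 0 < W rb c1 → W rc c0 < + 0 → + 0 < W ra c0 →
  norm1 ((W ⊕ moveArr (bm rc rb c1 j rc≢rb c1≢j)) ⊕ moveArr (bm rc ra c0 c1 rc≢ra c0≢c1)) ℕ.< norm1 W
norm1-⊕-two-moves-< {W = W} {ra} {rb} {rc} {c0} {c1} {j} rc≢rb c1≢j rc≢ra c0≢c1
                    0<Wrcj 0<Wrbc1 Wrcc0<0 0<Wrac0 = begin-strict
  norm1 ((W ⊕ moveArr (bm rc rb c1 j rc≢rb c1≢j)) ⊕ moveArr (bm rc ra c0 c1 rc≢ra c0≢c1))
    ≡⟨ norm1-cong (λ a b → as-updates (W a b) (E rc c1 a b) (E rb j a b) (E rc j a b) (E rb c1 a b)
                                      (E rc c0 a b) (E ra c1 a b) (E ra c0 a b)) ⟩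
  norm1 W₆              ≤⟨ norm1-upd-≤ W₅ (+ 1) ra c1 ⟩
  suc (norm1 W₅)        ≤⟨ s≤s (norm1-upd-≤ W₄ (+ 1) rb j) ⟩
  suc (suc (norm1 W₄))  ≤⟨ s≤s (norm1-upd-pos W₃ ra c0 (subst (+ 0 <_) (sym W₃-at-ra-c0) 0<Wrac0)) ⟩
  suc (norm1 W₃)        ≤⟨ norm1-upd-neg W₂ rc c0 (subst (_< + 0) (sym W₂-at-rc-c0) Wrcc0<0) ⟩
  norm1 W₂              <⟨ norm1-upd-pos W₁ rb c1 (subst (+ 0 <_) (sym W₁-at-rb-c1) 0<Wrbc1) ⟩
  norm1 W₁              <⟨ norm1-upd-pos W rc j 0<Wrcj ⟩
  norm1 W               ∎
  where
  open ℕP.≤-Reasoning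
  c0≢j : c0 ≢ j
  c0≢j refl = ℤP.<-asym 0<Wrcj Wrcc0<0
  W₁ W₂ W₃ W₄ W₅ W₆ : Arr _
  W₁ = upd W -[1+ 0 ] rc j
  W₂ = upd W₁ -[1+ 0 ] rb c1
  W₃ = upd W₂ (+ 1) rc c0
  W₄ = upd W₃ -[1+ 0 ] ra c0
  W₅ = upd W₄ (+ 1) rb j
  W₆ = upd W₅ (+ 1) ra c1
  as-updates : ∀ w e₁ e₂ e₃ e₄ e₅ e₆ e₇ →
    (w + ((e₁ + e₂) - (e₃ + e₄))) + ((e₅ + e₆) - (e₁ + e₇)) ≡
    (((((w + -[1+ 0 ] * e₃) + -[1+ 0 ] * e₄) + + 1 * e₅) + -[1+ 0 ] * e₇) + + 1 * e₂) + + 1 * e₆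
  as-updates = solve-∀
  W₁-at-rb-c1 : W₁ rb c1 ≡ W rb c1
  W₁-at-rb-c1 = upd-≢ W -[1+ 0 ] rc j (rc≢rb ∘ sym ∘ proj₁)
  W₂-at-rc-c0 : W₂ rc c0 ≡ W rc c0
  W₂-at-rc-c0 = trans (upd-≢ W₁ -[1+ 0 ] rb c1 (rc≢rb ∘ proj₁)) (upd-≢ W -[1+ 0 ] rc j (c0≢j ∘ proj₂))
  W₃-at-ra-c0 : W₃ ra c0 ≡ W ra c0
  W₃-at-ra-c0 = trans (upd-≢ W₂ (+ 1) rc c0 (rc≢ra ∘ sym ∘ proj₁))
               (trans (upd-≢ W₁ -[1+ 0 ] rb c1 (c0≢c1 ∘ proj₂))
                      (upd-≢ W -[1+ 0 ] rc j (rc≢ra ∘ sym ∘ proj₁)))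

⊕-sumMoves₁ : ∀ {n} (W : Arr n) B a b → (W ⊕ sumMoves (B ∷ [])) a b ≡ (W ⊕ moveArr B) a b
⊕-sumMoves₁ W B a b = cong (_+_ (W a b)) (ℤP.+-identityʳ (moveArr B a b))

⊕-sumMoves₂ : ∀ {n} (W : Arr n) B₁ B₂ a b →
  (W ⊕ sumMoves (B₁ ∷ B₂ ∷ [])) a b ≡ ((W ⊕ moveArr B₁) ⊕ moveArr B₂) a b
⊕-sumMoves₂ W B₁ B₂ a b = reassoc (W a b) (moveArr B₁ a b) (moveArr B₂ a b)
  where
  reassoc : ∀ w m₁ m₂ → w + (m₁ + (m₂ + + 0)) ≡ w + m₁ + m₂
  reassoc = solve-∀

ConstantColumn : ∀ {n} → Subset n → Fin (suc n) → Set
ConstantColumn S c = ∀ a a' → S a c ≡ S a' c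

module _ {n} {S : Subset n} {X Y : Table n} where

  private
    Z : Arr n
    Z = toArr X ⊖ toArr Y

    1≤X : ∀ {a b} → + 0 < Z a b → + 1 ℤ.≤ toArr X a b
    1≤X {a} {b} 0<Z = +≤+ (ℤP.drop‿+<+ (ℤP.<-≤-trans 0<Z (ℤP.i-j≤i (+ X a b) (+ Y a b))))

  positive-in-row : SameFiber S X Y → ∀ {r c} → Z r c < + 0 → ∃ λ j → + 0 < Z r j
  positive-in-row fib {r} {c} Zrc<0 =
    map₂ ℤP.≰⇒> (FinP.¬∀⟶∃¬ _ (λ j → Z r j ℤ.≤ + 0) (λ j → Z r j ℤP.≤? + 0)
                               not-all-nonpositive)
    where
    row-balanced : rowSum Z r ≡ + 0
    row-balanced = begin
      rowSum Z r                                 ≡⟨ ⊖-hom (rowSum-linear r) (toArr X) (toArr Y) ⟩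
      rowSum (toArr X) r - rowSum (toArr Y) r    ≡⟨ cong (_-_ (rowSum (toArr X) r)) (proj₁ (proj₂ fib) r) ⟩
      rowSum (toArr X) r - rowSum (toArr X) r    ≡⟨ ℤP.+-inverseʳ (rowSum (toArr X) r) ⟩
      + 0                                        ∎
      where open ≡-Reasoning
    not-all-nonpositive : ¬ (∀ j → Z r j ℤ.≤ + 0)
    not-all-nonpositive Z≤0 =
      ℤP.<-irrefl row-balanced (subst (rowSum Z r <_) (∑-zero {suc n}) (∑-mono-< Z≤0 c Zrc<0))

  reducible-by-moves : (Bs : List (BasicMove n)) → All (InB0 S) Bs → 0 ℕ.< length Bs →
    (∀ k → 1 ≤ k → k ≤ length Bs → InFiber S X (toArr X ⊕ sumMoves (take k Bs))) →
    norm1 (Z ⊕ sumMoves Bs) ℕ.< norm1 Z → Reducible S X Y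
  reducible-by-moves Bs Bs∈B₀ nonempty prefixes shrinks =
    Bs , [] , Bs∈B₀ , [] ,
    subst (0 ℕ.<_) (sym (ℕP.+-identityʳ (length Bs))) nonempty ,
    prefixes , (λ { (suc _) _ () }) ,
    subst (ℕ._< norm1 Z) (norm1-cong (λ a b → sym (ℤP.+-identityʳ ((Z ⊕ sumMoves Bs) a b)))) shrinks

  reducible-by-one-move : ∀ {ra rc c0 j} → S rc c0 ≡ S ra c0 → S rc j ≡ S ra j →
    + 0 < Z ra c0 → Z rc c0 < + 0 → + 0 < Z rc j → Reducible S X Y
  reducible-by-one-move {ra} {rc} {c0} {j} Sc0 Sj za zc zj =
    reducible-by-moves (B ∷ []) (InB0-of-columns B Sc0 Sj ∷ []) (s≤s z≤n) prefix
      (subst (ℕ._< norm1 Z) (norm1-cong (λ a b → sym (⊕-sumMoves₁ Z B a b))) (norm1-⊕-moveArr-< B zj za zc))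
    where
    rc≢ra : rc ≢ ra
    rc≢ra refl = ℤP.<-asym za zc
    c0≢j : c0 ≢ j
    c0≢j refl = ℤP.<-asym zj zc
    B : BasicMove n
    B = bm rc ra c0 j rc≢ra c0≢j
    prefix : ∀ k → 1 ≤ k → k ≤ 1 → InFiber S X (toArr X ⊕ sumMoves (take k (B ∷ [])))
    prefix 1 _ _ = InFiber-cong {S = S} (λ a b → sym (⊕-sumMoves₁ (toArr X) B a b))
                     (InFiber-moveArr B {S} (InFiber-refl {S = S}) (InB0-of-columns B Sc0 Sj) (1≤X zj) (1≤X za))
    prefix (suc (suc _)) _ (s≤s ())

  reducible-by-two-moves : ∀ {ra rb rc c0 c1 j} → ConstantColumn S c0 → ConstantColumn S c1 →
    rb ≢ rc → c0 ≢ c1 → c1 ≢ j → S rc j ≡ S rb j →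
    + 0 < Z ra c0 → Z rc c0 < + 0 → + 0 < Z rb c1 → + 0 < Z rc j → Reducible S X Y
  reducible-by-two-moves {ra} {rb} {rc} {c0} {c1} {j} const₀ const₁ rb≢rc c0≢c1 c1≢j Sj za zc zb zj =
    reducible-by-moves (B₁ ∷ B₂ ∷ []) (B₁∈B₀ ∷ B₂∈B₀ ∷ []) (s≤s z≤n) prefix
      (subst (ℕ._< norm1 Z) (norm1-cong (λ a b → sym (⊕-sumMoves₂ Z B₁ B₂ a b)))
        (norm1-⊕-two-moves-< (≢-sym rb≢rc) c1≢j rc≢ra c0≢c1 zj zb zc za))
    where
    rc≢ra : rc ≢ ra
    rc≢ra refl = ℤP.<-asym za zc
    c0≢j : c0 ≢ j
    c0≢j refl = ℤP.<-asym zj zc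
    B₁ B₂ : BasicMove n
    B₁ = bm rc rb c1 j (≢-sym rb≢rc) c1≢j
    B₂ = bm rc ra c0 c1 rc≢ra c0≢c1
    B₁∈B₀ : InB0 S B₁
    B₁∈B₀ = InB0-of-columns B₁ (const₁ rc rb) Sj
    B₂∈B₀ : InB0 S B₂
    B₂∈B₀ = InB0-of-columns B₂ (const₀ rc ra) (const₁ rc ra)
    X₁ : Arr n
    X₁ = toArr X ⊕ moveArr B₁
    F₁ : InFiber S X X₁
    F₁ = InFiber-moveArr B₁ {S} (InFiber-refl {S = S}) B₁∈B₀ (1≤X zj) (1≤X zb)
    1≤X₁-at-rc-c1 : + 1 ℤ.≤ X₁ rc c1
    1≤X₁-at-rc-c1 = subst (λ m → + 1 ℤ.≤ + X rc c1 + m) (sym (moveArr-ij B₁)) (+≤+ (ℕP.m≤n+m 1 (X rc c1)))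
    1≤X₁-at-ra-c0 : + 1 ℤ.≤ X₁ ra c0
    1≤X₁-at-ra-c0 = subst (+ 1 ℤ.≤_)
      (sym (trans (cong (_+_ (+ X ra c0)) (moveArr-outside B₁ ra c0≢c1 c0≢j)) (ℤP.+-identityʳ (+ X ra c0))))
      (1≤X za)
    prefix : ∀ k → 1 ≤ k → k ≤ 2 → InFiber S X (toArr X ⊕ sumMoves (take k (B₁ ∷ B₂ ∷ [])))
    prefix 1 _ _ = InFiber-cong {S = S} (λ a b → sym (⊕-sumMoves₁ (toArr X) B₁ a b)) F₁
    prefix 2 _ _ = InFiber-cong {S = S} (λ a b → sym (⊕-sumMoves₂ (toArr X) B₁ B₂ a b))
                     (InFiber-moveArr B₂ {S} F₁ B₂∈B₀ 1≤X₁-at-rc-c1 1≤X₁-at-ra-c0)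
    prefix (suc (suc (suc _))) _ (s≤s (s≤s ()))

  reducible-between : SameFiber S X Y → ∀ {ra rb rc c0 c1} →
    ConstantColumn S c0 → ConstantColumn S c1 → c0 ≢ c1 → rb ≢ rc →
    (∀ j → S ra j ≡ S rc j ⊎ S rb j ≡ S rc j) →
    + 0 < Z ra c0 → Z rc c0 < + 0 → + 0 < Z rb c1 → Reducible S X Y
  reducible-between fib {ra} {rb} {rc} {c0} {c1} const₀ const₁ c0≢c1 rb≢rc agrees za zc zb
    with positive-in-row fib zc
  ... | j , zj with j ≟ c1 | agrees j
  ...   | yes refl | _       = reducible-by-one-move (const₀ rc ra) (const₁ rc ra) za zc zj
  ...   | no _     | inj₁ Sj = reducible-by-one-move (const₀ rc ra) (sym Sj) za zc zj
  ...   | no j≢c1  | inj₂ Sj =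
    reducible-by-two-moves const₀ const₁ rb≢rc c0≢c1 (≢-sym j≢c1) (sym Sj) za zc zb zj

inS-yes : ∀ {n} {a : Fin n} {j : Fin (suc n)} → toℕ a ℕ.+ toℕ j ℕ.< n → inS a j ≡ + 1
inS-yes {n} {a} {j} a+j<n with toℕ a ℕ.+ toℕ j ℕ.<? n
... | yes _     = refl
... | no a+j≮n = contradiction a+j<n a+j≮n

inS-no : ∀ {n} {a : Fin n} {j : Fin (suc n)} → ¬ (toℕ a ℕ.+ toℕ j ℕ.< n) → inS a j ≡ + 0
inS-no {n} {a} {j} a+j≮n with toℕ a ℕ.+ toℕ j ℕ.<? n
... | yes a+j<n = contradiction a+j<n a+j≮n
... | no _      = refl

inS-first-column : ∀ {n} → ConstantColumn (inS {n}) zero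
inS-first-column {n} a a' = trans (in-first a) (sym (in-first a'))
  where
  in-first : ∀ a → inS a zero ≡ + 1
  in-first a = inS-yes (subst (ℕ._< n) (sym (ℕP.+-identityʳ (toℕ a))) (FinP.toℕ<n a))

inS-last-column : ∀ {n} → ConstantColumn (inS {n}) (fromℕ n)
inS-last-column {n} a a' = trans (not-in-last a) (sym (not-in-last a'))
  where
  not-in-last : ∀ a → inS a (fromℕ n) ≡ + 0
  not-in-last a = inS-no (ℕP.m+n≮n (toℕ a) n ∘ subst (λ m → toℕ a ℕ.+ m ℕ.< n) (FinP.toℕ-fromℕ n))

inS-between : ∀ {n} {a b c : Fin n} → toℕ a ℕ.≤ toℕ c → toℕ c ℕ.≤ toℕ b →
  ∀ j → inS a j ≡ inS c j ⊎ inS b j ≡ inS c j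
inS-between {n} {c = c} a≤c c≤b j with toℕ c ℕ.+ toℕ j ℕ.<? n
... | yes c+j<n = inj₁ (inS-yes (ℕP.≤-<-trans (ℕP.+-monoˡ-≤ (toℕ j) a≤c) c+j<n))
... | no c+j≮n  = inj₂ (inS-no (c+j≮n ∘ ℕP.≤-<-trans (ℕP.+-monoˡ-≤ (toℕ j) c≤b)))

lemma6 : (n : ℕ) → 2 ≤ n → (X Y : Table n) →
    SameFiber inS X Y → ¬ (∀ i j → X i j ≡ Y i j) →
    (ia ib ic id : Fin n) →
    + 0 < (toArr X ⊖ toArr Y) ia zero →
    + 0 < (toArr X ⊖ toArr Y) ib (fromℕ n) →
    (toArr X ⊖ toArr Y) ic zero < + 0 →
    (toArr X ⊖ toArr Y) id (fromℕ n) < + 0 →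
    ((ia <ᶠ ic × ic <ᶠ ib) ⊎ (ia <ᶠ id × id <ᶠ ib) ⊎
    (ib <ᶠ ic × ic <ᶠ ia) ⊎ (ib <ᶠ id × id <ᶠ ia)) →
    Reducible inS X Y
-- The hypothesis X ≢ Y is implied by the sign conditions and not needed.
lemma6 n (s≤s (s≤s _)) X Y fib _ ia ib ic id za zb zc zd = λ where
    (inj₁ (a<c , c<b))               → via-ic (≢-sym (FinP.<⇒≢ c<b)) (between a<c c<b)
    (inj₂ (inj₁ (a<d , d<b)))        → via-id (FinP.<⇒≢ a<d) (swap ∘ between a<d d<b)
    (inj₂ (inj₂ (inj₁ (b<c , c<a)))) → via-ic (FinP.<⇒≢ b<c) (swap ∘ between b<c c<a)
    (inj₂ (inj₂ (inj₂ (b<d , d<a)))) → via-id (≢-sym (FinP.<⇒≢ d<a)) (between b<d d<a)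
  where
  between : ∀ {a b c} → a <ᶠ c → c <ᶠ b → ∀ j → inS a j ≡ inS c j ⊎ inS b j ≡ inS c j
  between a<c c<b = inS-between (ℕP.<⇒≤ a<c) (ℕP.<⇒≤ c<b)
  via-ic : ib ≢ ic → (∀ j → inS ia j ≡ inS ic j ⊎ inS ib j ≡ inS ic j) → Reducible inS X Y
  via-ic ib≢ic agrees = reducible-between fib inS-first-column inS-last-column (λ ()) ib≢ic agrees za zc zb
  via-id : ia ≢ id → (∀ j → inS ib j ≡ inS id j ⊎ inS ia j ≡ inS id j) → Reducible inS X Y
  via-id ia≢id agrees = reducible-between fib inS-last-column inS-first-column (λ ()) ia≢id agrees zb zd za
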